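{- Let $n\ge1$. For $0\le i\le\lfloor n/2\rfloor$, let $T(n,i)$ be the number of $i$-element subsets $\{\gamma_1<\gamma_2<\dots<\gamma_i\}\subseteq\{1,\dots,n\}$ such that $\gamma_j\ne 2j$ for every $j=1,\dots,i$. Then $T(n,0)=1$, and for $1\le i\le\lfloor n/2\rfloor$, $$T(n,i)=\binom{n}{i}-\binom{n}{i-1}.$$ -}

module Defs where

open import Data.Bool using (Bool; true; false)
open import Data.Nat using (ℕ; zero; suc; _*_)
open import Data.Nat.Properties using (_≟_)
open import Data.List using (List; []; _∷_; map; _++_; length; filter)
open import Data.Vec using (Vec; []; _∷_)
open import Data.Fin.Subset using (Subset; ∣_∣)
open import Data.Product using (_×_; _,_)
open import Data.Unit using (⊤; tt)
open import Relation.Binary.PropositionalEquality using (_≢_)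
open import Relation.Nullary using (Dec; yes; no; ¬_)
open import Relation.Nullary.Decidable using (_×-dec_)
open import Relation.Unary using (Decidable)

-- A subset of {1,…,n} is a Subset n (= Vec Bool n); position k (0-based)
-- of the vector encodes membership of the number k+1.

allSubsets : (n : ℕ) → List (Subset n)
allSubsets zero = [] ∷ []
allSubsets (suc n) = map (true ∷_) (allSubsets n) ++ map (false ∷_) (allSubsets n)

elemsFrom : {n : ℕ} → ℕ → Subset n → List ℕ
elemsFrom o [] = []
elemsFrom o (true ∷ s) = suc o ∷ elemsFrom (suc o) s
elemsFrom o (false ∷ s) = elemsFrom (suc o) s

elems : {n : ℕ} → Subset n → List ℕ
elems = elemsFrom 0

AvoidsFrom : ℕ → List ℕ → Set
AvoidsFrom j [] = ⊤
AvoidsFrom j (g ∷ gs) = (g ≢ 2 * j) × AvoidsFrom (suc j) gs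

avoidsFrom? : (j : ℕ) → Decidable (AvoidsFrom j)
avoidsFrom? j [] = yes tt
avoidsFrom? j (g ∷ gs) with g ≟ 2 * j
... | yes e = no (λ { (ne , _) → ne e })
... | no ne = Relation.Nullary.Decidable.map′ (ne ,_) (λ { (_ , r) → r }) (avoidsFrom? (suc j) gs)

Good : (n i : ℕ) → Subset n → Set
Good n i S = (∣ S ∣ ≡ i) × AvoidsFrom 1 (elems S)
  where open import Relation.Binary.PropositionalEquality using (_≡_)

good? : (n i : ℕ) → Decidable (Good n i)
good? n i S = (∣ S ∣ ≟ i) ×-dec avoidsFrom? 1 (elems S)

T : ℕ → ℕ → ℕ
T n i = length (filter (good? n i) (allSubsets n))

{-# OPTIONS --safe #-}
module Submission where

-- Split the good i-subsets of {1,…,n+1} according to whether they contain n+1.  Those that do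
-- are good (i−1)-subsets of {1,…,n} followed by γ_i = n+1, which is allowed unless n+1 = 2i.
-- So T(n+1,0) = T(n,0) and T(n+1,i) = T(n,i−1) + T(n,i), except that T(n+1,i) = T(n,i) when
-- n+1 = 2i.  Against Pascal's rule this shows, by simultaneous induction on n, that
-- T(n,i) = C(n,i) − C(n,i−1) when 2i ≤ n and T(n,i) = C(n,i) − C(n,i+1) when n < 2i; the two
-- regimes are glued along n ∈ {2i−1, 2i} by the symmetry C(n,j) = C(n,n−j).

open import Defs
open import Data.Bool using (Bool; true; false)
open import Data.Fin.Subset using (Subset; ∣_∣)
open import Data.List using (List; []; _∷_; [_]; _++_; map; length; filter)
open import Data.List.Properties using (filter-++; filter-≐; filter-none; length-++; length-map)
open import Data.List.Relation.Unary.All using (universal)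
open import Data.Nat using (ℕ; zero; suc; _+_; _*_; _∸_; _/_; _≤_; _<_; _<?_; NonZero)
open import Data.Nat.Combinatorics using (_C_; nCk≡nC[n∸k]; nCk+nC[k+1]≡[n+1]C[k+1]; k>n⇒nCk≡0)
open import Data.Nat.DivMod using (m/n*n≤m)
open import Data.Nat.Properties
open import Algebra.Properties.CommutativeSemigroup +-commutativeSemigroup using (interchange; x∙yz≈y∙xz)
open import Data.Product using (_×_; _,_; proj₁; proj₂; swap)
open import Data.Sum using (inj₁; inj₂)
open import Data.Unit using (⊤)
open import Data.Vec using ([]; _∷_; _∷ʳ_)
open import Function using (_∘_; id; _⇔_; mk⇔; Equivalence)
open import Relation.Binary.PropositionalEquality
  using (_≡_; _≢_; refl; sym; trans; cong; cong₂; subst; module ≡-Reasoning)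
open import Relation.Nullary using (¬_; does; yes; no)
open import Relation.Unary using (Pred; Decidable; _≐_)

open Equivalence using (to; from)
open ≡-Reasoning

filter-map : ∀ {a b p} {A : Set a} {B : Set b} {P : Pred B p}
             (P? : Decidable P) (f : A → B) (xs : List A) →
             filter P? (map f xs) ≡ map f (filter (P? ∘ f) xs)
filter-map P? f []       = refl
filter-map P? f (x ∷ xs) with does (P? (f x))
... | true  = cong (f x ∷_) (filter-map P? f xs)
... | false = filter-map P? f xs

2*m≡m+m : ∀ m → 2 * m ≡ m + m
2*m≡m+m m = cong (m +_) (+-identityʳ m)

m≤n/o⇒o*m≤n : ∀ {m n o} .{{_ : NonZero o}} → m ≤ n / o → o * m ≤ n
m≤n/o⇒o*m≤n {n = n} {o} m≤n/o =
  ≤-trans (*-monoʳ-≤ o m≤n/o) (subst (_≤ n) (*-comm (n / o) o) (m/n*n≤m n o))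

count : ∀ {n p} {P : Pred (Subset n) p} → Decidable P → ℕ
count {n} P? = length (filter P? (allSubsets n))

count-cong : ∀ {n p q} {P : Pred (Subset n) p} {Q : Pred (Subset n) q}
             (P? : Decidable P) (Q? : Decidable Q) → P ≐ Q → count P? ≡ count Q?
count-cong {n} P? Q? P≐Q = cong length (filter-≐ P? Q? P≐Q (allSubsets n))

count-none : ∀ {n p} {P : Pred (Subset n) p} (P? : Decidable P) → (∀ s → ¬ P s) → count P? ≡ 0
count-none {n} P? ¬P = cong length (filter-none P? (universal ¬P (allSubsets n)))

count-∷ : ∀ {n p} {P : Pred (Subset (suc n)) p} (P? : Decidable P) →
          count P? ≡ count (P? ∘ (true ∷_)) + count (P? ∘ (false ∷_))
count-∷ {n} P? = begin
  length (filter P? (map (true ∷_) ss ++ map (false ∷_) ss))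
    ≡⟨ cong length (filter-++ P? (map (true ∷_) ss) (map (false ∷_) ss)) ⟩
  length (filter P? (map (true ∷_) ss) ++ filter P? (map (false ∷_) ss))
    ≡⟨ length-++ (filter P? (map (true ∷_) ss)) ⟩
  length (filter P? (map (true ∷_) ss)) + length (filter P? (map (false ∷_) ss))
    ≡⟨ cong₂ _+_ (length-filter-map (true ∷_)) (length-filter-map (false ∷_)) ⟩
  count (P? ∘ (true ∷_)) + count (P? ∘ (false ∷_)) ∎
  where
  ss : List (Subset n)
  ss = allSubsets n
  length-filter-map : ∀ f → length (filter P? (map f ss)) ≡ length (filter (P? ∘ f) ss)
  length-filter-map f = trans (cong length (filter-map P? f ss)) (length-map f (filter (P? ∘ f) ss))

count-∷ʳ : ∀ {n p} {P : Pred (Subset (suc n)) p} (P? : Decidable P) →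
           count P? ≡ count (P? ∘ (_∷ʳ true)) + count (P? ∘ (_∷ʳ false))
count-∷ʳ {zero} {P = P} P? = trans (count-∷ P?)
  (cong₂ _+_ (count-cong (P? ∘ (true ∷_)) (P? ∘ (_∷ʳ true)) (first≐last true))
             (count-cong (P? ∘ (false ∷_)) (P? ∘ (_∷ʳ false)) (first≐last false)))
  where
  -- Subset 0 has no definitional eta, so the two sides only agree after matching on [].
  first≐last : ∀ b → P ∘ (b ∷_) ≐ P ∘ (_∷ʳ b)
  first≐last b = (λ { {[]} → id }) , (λ { {[]} → id })
count-∷ʳ {suc n} P? = begin
  count P?
    ≡⟨ count-∷ P? ⟩
  count (P? ∘ (true ∷_)) + count (P? ∘ (false ∷_))
    ≡⟨ cong₂ _+_ (count-∷ʳ (P? ∘ (true ∷_))) (count-∷ʳ (P? ∘ (false ∷_))) ⟩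
  (c true true + c true false) + (c false true + c false false)
    ≡⟨ interchange (c true true) (c true false) (c false true) (c false false) ⟩
  (c true true + c false true) + (c true false + c false false)
    ≡⟨ cong₂ _+_ (count-∷ (P? ∘ (_∷ʳ true))) (count-∷ (P? ∘ (_∷ʳ false))) ⟨
  count (P? ∘ (_∷ʳ true)) + count (P? ∘ (_∷ʳ false)) ∎
  where
  c : Bool → Bool → ℕ
  c first last = count (λ s → P? (first ∷ (s ∷ʳ last)))

∣p∷ʳtrue∣≡1+∣p∣ : ∀ {n} (p : Subset n) → ∣ p ∷ʳ true ∣ ≡ suc ∣ p ∣
∣p∷ʳtrue∣≡1+∣p∣ []          = refl
∣p∷ʳtrue∣≡1+∣p∣ (true ∷ p)  = cong suc (∣p∷ʳtrue∣≡1+∣p∣ p)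
∣p∷ʳtrue∣≡1+∣p∣ (false ∷ p) = ∣p∷ʳtrue∣≡1+∣p∣ p

∣p∷ʳfalse∣≡∣p∣ : ∀ {n} (p : Subset n) → ∣ p ∷ʳ false ∣ ≡ ∣ p ∣
∣p∷ʳfalse∣≡∣p∣ []          = refl
∣p∷ʳfalse∣≡∣p∣ (true ∷ p)  = cong suc (∣p∷ʳfalse∣≡∣p∣ p)
∣p∷ʳfalse∣≡∣p∣ (false ∷ p) = ∣p∷ʳfalse∣≡∣p∣ p

length-elemsFrom : ∀ {n} o (p : Subset n) → length (elemsFrom o p) ≡ ∣ p ∣
length-elemsFrom o []          = refl
length-elemsFrom o (true ∷ p)  = cong suc (length-elemsFrom (suc o) p)
length-elemsFrom o (false ∷ p) = length-elemsFrom (suc o) p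

elemsFrom-∷ʳ-true : ∀ {n} o (p : Subset n) → elemsFrom o (p ∷ʳ true) ≡ elemsFrom o p ++ [ suc (o + n) ]
elemsFrom-∷ʳ-true         o []          rewrite +-identityʳ o = refl
elemsFrom-∷ʳ-true {suc n} o (true ∷ p)  rewrite +-suc o n = cong (suc o ∷_) (elemsFrom-∷ʳ-true (suc o) p)
elemsFrom-∷ʳ-true {suc n} o (false ∷ p) rewrite +-suc o n = elemsFrom-∷ʳ-true (suc o) p

elemsFrom-∷ʳ-false : ∀ {n} o (p : Subset n) → elemsFrom o (p ∷ʳ false) ≡ elemsFrom o p
elemsFrom-∷ʳ-false o []          = refl
elemsFrom-∷ʳ-false o (true ∷ p)  = cong (suc o ∷_) (elemsFrom-∷ʳ-false (suc o) p)
elemsFrom-∷ʳ-false o (false ∷ p) = elemsFrom-∷ʳ-false (suc o) p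

AvoidsFrom-++ : ∀ j xs x → AvoidsFrom j (xs ++ [ x ]) ⇔ (AvoidsFrom j xs × x ≢ 2 * (j + length xs))
AvoidsFrom-++ j [] x =
  subst (λ m → AvoidsFrom j [ x ] ⇔ (⊤ × x ≢ 2 * m)) (sym (+-identityʳ j)) (mk⇔ swap swap)
AvoidsFrom-++ j (g ∷ gs) x rewrite +-suc j (length gs) =
  mk⇔ (λ (g≢ , a) → let a′ , x≢ = to ih a in (g≢ , a′) , x≢)
      (λ ((g≢ , a′) , x≢) → g≢ , from ih (a′ , x≢))
  where
  ih : AvoidsFrom (suc j) (gs ++ [ x ]) ⇔ (AvoidsFrom (suc j) gs × x ≢ 2 * (suc j + length gs))
  ih = AvoidsFrom-++ (suc j) gs x

Good-∷ʳ-false : ∀ {n i} → Good (suc n) i ∘ (_∷ʳ false) ≐ Good n i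
Good-∷ʳ-false =
  (λ {p} (c , a) → trans (sym (∣p∷ʳfalse∣≡∣p∣ p)) c ,
                   subst (AvoidsFrom 1) (elemsFrom-∷ʳ-false 0 p) a) ,
  (λ {p} (c , a) → trans (∣p∷ʳfalse∣≡∣p∣ p) c ,
                   subst (AvoidsFrom 1) (sym (elemsFrom-∷ʳ-false 0 p)) a)

Good-∷ʳ-true : ∀ {n k} (p : Subset n) →
               Good (suc n) (suc k) (p ∷ʳ true) ⇔ (Good n k p × suc n ≢ 2 * suc k)
Good-∷ʳ-true {n} {k} p rewrite ∣p∷ʳtrue∣≡1+∣p∣ p | elemsFrom-∷ʳ-true 0 p = mk⇔
  (λ (c , a) → let a′ , n≢ = to avoids a
               in (suc-injective c , a′) , subst LastAvoids (length-elems≡ (suc-injective c)) n≢)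
  (λ ((c , a′) , n≢) → cong suc c ,
                       from avoids (a′ , subst LastAvoids (sym (length-elems≡ c)) n≢))
  where
  LastAvoids : ℕ → Set
  LastAvoids m = suc n ≢ 2 * suc m
  avoids : AvoidsFrom 1 (elems p ++ [ suc n ]) ⇔
           (AvoidsFrom 1 (elems p) × LastAvoids (length (elems p)))
  avoids = AvoidsFrom-++ 1 (elems p) (suc n)
  length-elems≡ : ∣ p ∣ ≡ k → length (elems p) ≡ k
  length-elems≡ = trans (length-elemsFrom 0 p)

¬Good-∷ʳ-true-zero : ∀ {n} (p : Subset n) → ¬ Good (suc n) 0 (p ∷ʳ true)
¬Good-∷ʳ-true-zero p (c , _) = 1+n≢0 (trans (sym (∣p∷ʳtrue∣≡1+∣p∣ p)) c)

T-∷ʳ : ∀ n i → T (suc n) i ≡ count (good? (suc n) i ∘ (_∷ʳ true)) + T n i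
T-∷ʳ n i = trans (count-∷ʳ (good? (suc n) i))
  (cong (count (good? (suc n) i ∘ (_∷ʳ true)) +_)
        (count-cong (good? (suc n) i ∘ (_∷ʳ false)) (good? n i) Good-∷ʳ-false))

T[n,0]≡1 : ∀ n → T n 0 ≡ 1
T[n,0]≡1 zero    = refl
T[n,0]≡1 (suc n) = trans (T-∷ʳ n 0)
  (cong₂ _+_ (count-none (good? (suc n) 0 ∘ (_∷ʳ true)) ¬Good-∷ʳ-true-zero) (T[n,0]≡1 n))

T[1+n,1+k]≡T[n,1+k] : ∀ {n k} → suc n ≡ 2 * suc k → T (suc n) (suc k) ≡ T n (suc k)
T[1+n,1+k]≡T[n,1+k] {n} {k} 1+n≡2[1+k] = trans (T-∷ʳ n (suc k))
  (cong (_+ T n (suc k)) (count-none (good? (suc n) (suc k) ∘ (_∷ʳ true))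
                                     (λ p g → proj₂ (to (Good-∷ʳ-true p) g) 1+n≡2[1+k])))

T[1+n,1+k]≡T[n,k]+T[n,1+k] : ∀ {n k} → suc n ≢ 2 * suc k →
                             T (suc n) (suc k) ≡ T n k + T n (suc k)
T[1+n,1+k]≡T[n,k]+T[n,1+k] {n} {k} 1+n≢2[1+k] = trans (T-∷ʳ n (suc k))
  (cong (_+ T n (suc k)) (count-cong (good? (suc n) (suc k) ∘ (_∷ʳ true)) (good? n k) ≐Good))
  where
  ≐Good : Good (suc n) (suc k) ∘ (_∷ʳ true) ≐ Good n k
  ≐Good = (λ {p} → proj₁ ∘ to (Good-∷ʳ-true p)) ,
          (λ {p} g → from (Good-∷ʳ-true p) (g , 1+n≢2[1+k]))

-- (n choose i−1), without the truncation that makes n C (i ∸ 1) equal 1 at i = 0.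
infixl 6.5 _C⁻_

_C⁻_ : ℕ → ℕ → ℕ
n C⁻ zero  = 0
n C⁻ suc i = n C i

[1+n]Ci≡nC⁻i+nCi : ∀ n i → suc n C i ≡ n C⁻ i + n C i
[1+n]Ci≡nC⁻i+nCi n zero    = refl
[1+n]Ci≡nC⁻i+nCi n (suc i) = sym (nCk+nC[k+1]≡[n+1]C[k+1] n i)

nC⁻i≡nCj : ∀ {n} i j → i + j ≡ suc n → n C⁻ i ≡ n C j
nC⁻i≡nCj {n} zero j refl = sym (k>n⇒nCk≡0 (n<1+n n))
nC⁻i≡nCj (suc i) j refl = trans (nCk≡nC[n∸k] (m≤m+n i j)) (cong ((i + j) C_) (m+n∸m≡n i j))

2i≤n⇒T[n,i]+nC⁻i≡nCi : ∀ n i → 2 * i ≤ n → T n i + n C⁻ i ≡ n C i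
n<2i⇒T[n,i]+nC[1+i]≡nCi : ∀ n i → n < 2 * i → T n i + n C suc i ≡ n C i

2i≤n⇒T[n,i]+nC⁻i≡nCi n       zero    _ = trans (+-identityʳ (T n 0)) (T[n,0]≡1 n)
2i≤n⇒T[n,i]+nC⁻i≡nCi zero    (suc k) ()
2i≤n⇒T[n,i]+nC⁻i≡nCi (suc n) (suc k) 2i≤1+n with m≤n⇒m<n∨m≡n 2i≤1+n
... | inj₁ 2i<1+n = begin
  T (suc n) (suc k) + suc n C k
    ≡⟨ cong₂ _+_ (T[1+n,1+k]≡T[n,k]+T[n,1+k] (>⇒≢ 2i<1+n)) ([1+n]Ci≡nC⁻i+nCi n k) ⟩
  (T n k + T n (suc k)) + (n C⁻ k + n C k)
    ≡⟨ interchange (T n k) (T n (suc k)) (n C⁻ k) (n C k) ⟩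
  (T n k + n C⁻ k) + (T n (suc k) + n C k)
    ≡⟨ cong₂ _+_ (2i≤n⇒T[n,i]+nC⁻i≡nCi n k 2k≤n)
                 (2i≤n⇒T[n,i]+nC⁻i≡nCi n (suc k) 2[1+k]≤n) ⟩
  n C k + n C suc k
    ≡⟨ nCk+nC[k+1]≡[n+1]C[k+1] n k ⟩
  suc n C suc k ∎
  where
  2[1+k]≤n : 2 * suc k ≤ n
  2[1+k]≤n = ≤-pred 2i<1+n
  2k≤n : 2 * k ≤ n
  2k≤n = ≤-trans (*-monoʳ-≤ 2 (n≤1+n k)) 2[1+k]≤n
... | inj₂ 2i≡1+n = begin
  T (suc n) (suc k) + suc n C k
    ≡⟨ cong₂ _+_ (T[1+n,1+k]≡T[n,1+k] (sym 2i≡1+n))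
                 (nC⁻i≡nCj (suc k) (2 + k) [1+k]+[2+k]≡2+n) ⟩
  T n (suc k) + suc n C (2 + k)
    ≡⟨ cong (T n (suc k) +_) (nCk+nC[k+1]≡[n+1]C[k+1] n (suc k)) ⟨
  T n (suc k) + (n C suc k + n C (2 + k))
    ≡⟨ x∙yz≈y∙xz (T n (suc k)) (n C suc k) (n C (2 + k)) ⟩
  n C suc k + (T n (suc k) + n C (2 + k))
    ≡⟨ cong (n C suc k +_) (n<2i⇒T[n,i]+nC[1+i]≡nCi n (suc k) (≤-reflexive (sym 2i≡1+n))) ⟩
  n C suc k + n C suc k
    ≡⟨ cong (_+ n C suc k) (nC⁻i≡nCj (suc k) (suc k) [1+k]+[1+k]≡1+n) ⟨
  n C k + n C suc k
    ≡⟨ nCk+nC[k+1]≡[n+1]C[k+1] n k ⟩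
  suc n C suc k ∎
  where
  [1+k]+[1+k]≡1+n : suc k + suc k ≡ suc n
  [1+k]+[1+k]≡1+n = trans (sym (2*m≡m+m (suc k))) 2i≡1+n
  [1+k]+[2+k]≡2+n : suc k + (2 + k) ≡ 2 + n
  [1+k]+[2+k]≡2+n = trans (+-suc (suc k) (suc k)) (cong suc [1+k]+[1+k]≡1+n)

n<2i⇒T[n,i]+nC[1+i]≡nCi zero    (suc k) _ = refl
n<2i⇒T[n,i]+nC[1+i]≡nCi (suc n) (suc k) 1+n<2i = begin
  T (suc n) (suc k) + suc n C (2 + k)
    ≡⟨ cong₂ _+_ (T[1+n,1+k]≡T[n,k]+T[n,1+k] (<⇒≢ 1+n<2i))
                 (sym (nCk+nC[k+1]≡[n+1]C[k+1] n (suc k))) ⟩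
  (T n k + T n (suc k)) + (n C suc k + n C (2 + k))
    ≡⟨ interchange (T n k) (T n (suc k)) (n C suc k) (n C (2 + k)) ⟩
  (T n k + n C suc k) + (T n (suc k) + n C (2 + k))
    ≡⟨ cong₂ _+_ T[n,k]+nC[1+k]≡nCk
                 (n<2i⇒T[n,i]+nC[1+i]≡nCi n (suc k) (<-trans (n<1+n n) 1+n<2i)) ⟩
  n C k + n C suc k
    ≡⟨ nCk+nC[k+1]≡[n+1]C[k+1] n k ⟩
  suc n C suc k ∎
  where
  T[n,k]+nC[1+k]≡nCk : T n k + n C suc k ≡ n C k
  T[n,k]+nC[1+k]≡nCk with n <? 2 * k
  ... | yes n<2k = n<2i⇒T[n,i]+nC[1+i]≡nCi n k n<2k
  ... | no  n≮2k =
    trans (cong (T n k +_) (sym (nC⁻i≡nCj k (suc k) k+[1+k]≡1+n)))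
          (2i≤n⇒T[n,i]+nC⁻i≡nCi n k 2k≤n)
    where
    2k≤n : 2 * k ≤ n
    2k≤n = ≮⇒≥ n≮2k
    n≤2k : n ≤ 2 * k
    n≤2k = ≤-pred (≤-pred (subst (suc (suc n) ≤_) (*-suc 2 k) 1+n<2i))
    k+[1+k]≡1+n : k + suc k ≡ suc n
    k+[1+k]≡1+n = trans (+-suc k k) (cong suc (trans (sym (2*m≡m+m k)) (≤-antisym 2k≤n n≤2k)))

theorem5p31 : (n : ℕ) → 1 ≤ n →
    (T n 0 ≡ 1) ×
    ((i : ℕ) → 1 ≤ i → i ≤ n / 2 → T n i ≡ (n C i) ∸ (n C (i ∸ 1)))
theorem5p31 n _ = T[n,0]≡1 n , λ where
  (suc k) _ 1+k≤n/2 → begin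
    T n (suc k)
      ≡⟨ m+n∸n≡m (T n (suc k)) (n C k) ⟨
    T n (suc k) + n C k ∸ n C k
      ≡⟨ cong (_∸ n C k) (2i≤n⇒T[n,i]+nC⁻i≡nCi n (suc k) (m≤n/o⇒o*m≤n 1+k≤n/2)) ⟩
    n C suc k ∸ n C k ∎
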